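{- If a finite set $X$ is $\omega^{2n+7}$-large$(\theta)$, then there is a subset $Y\subseteq X$ that is $\omega^n$-large$(\theta)$ and sparse.
   Context: Work in a language enriched with a first-order constant $c$ and a second-order constant $C$. Fix a $\Delta^0_0$ formula $\zeta(X\upharpoonright_z,t,x,y,z)$ with exactly the displayed free variables, and let $\theta(x,y,z)$ be $\zeta(C\upharpoonright_z,c,x,y,z)$. For finite sets, $A<B$ means every element of $A$ is less than every element of $B$. Finite sets $X<Y$ are $\theta$-apart if $\forall x<\max X\,\exists y<\min Y\,\forall z<\max Y\,\theta(x,y,z)$. Largeness$(\theta)$: $X$ is $\omega^0$-large$(\theta)$ if $X\neq\emptyset$; $X$ is $\omega^{n+1}$-large$(\theta)$ if $X\setminus\{\min X\}$ is $\omega^n\cdot\min X$-large$(\theta)$; $X$ is $\omega^n\cdot k$-large$(\theta)$ if there are $k$ pairwise $\theta$-apart $\omega^n$-large$(\theta)$ subsets $X_0<\dots<X_{k-1}$ of $X$. A set $X$ is sparse if for all $x<y$ in $X$, $x^{x^x}<y$. Standing convention: all finite sets considered satisfy $\min X\geq 4$ and $\min X\geq c$. -}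

module Defs where

open import Data.Nat using (ℕ; zero; suc; _<_; _≤_; _^_)
open import Data.Bool using (Bool)
open import Data.Fin using (Fin; toℕ)
import Data.Fin as Fin
open import Data.Vec using (Vec; tabulate; lookup)
open import Data.List using (List; []; _∷_)
open import Data.List.Membership.Propositional using (_∈_)
open import Data.List.Relation.Unary.Linked using (Linked)
open import Data.Product using (Σ; ∃; _×_; _,_)
open import Data.Empty using (⊥)
open import Data.Unit using (⊤)
open import Relation.Nullary using (Dec)

-- Finite sets of naturals are represented as strictly increasing lists.
FinSet : List ℕ → Set
FinSet X = Linked _<_ X

_⊆ₛ_ : List ℕ → List ℕ → Set
A ⊆ₛ B = ∀ {a} → a ∈ A → a ∈ B

_<ₛ_ : List ℕ → List ℕ → Set
A <ₛ B = ∀ {a b} → a ∈ A → b ∈ B → a < b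

-- Restriction C↾z of a second-order object C ⊆ ℕ, as its characteristic vector below z.
restrict : (ℕ → Bool) → (z : ℕ) → Vec Bool z
restrict C z = tabulate (λ (i : Fin z) → C (toℕ i))

-- θ(x,y,z) := ζ(C↾z, c, x, y, z); ζ takes (z, C↾z, t, x, y).
θ-of : ((z : ℕ) → Vec Bool z → ℕ → ℕ → ℕ → Set) → (ℕ → Bool) → ℕ → ℕ → ℕ → ℕ → Set
θ-of ζ C c x y z = ζ z (restrict C z) c x y

module _ (θ : ℕ → ℕ → ℕ → Set) where

  -- X, Y are θ-apart:  ∀ x < max X. ∃ y < min Y. ∀ z < max Y. θ(x,y,z)
  -- (for nonempty sets: "x < max X" ⇔ x is below some element of X,
  --  "y < min Y" ⇔ y is below every element of Y).
  Apart : List ℕ → List ℕ → Set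
  Apart X Y =
    ∀ x → (∃ λ a → a ∈ X × x < a) →
      ∃ λ y → (∀ {b} → b ∈ Y → y < b) ×
        (∀ z → (∃ λ b → b ∈ Y × z < b) → θ x y z)

  -- X is (ω^n · k)-large, given the notion "P = ω^n-large":
  -- there are k subsets X_0 < … < X_{k-1} of X, each a finite set, each P,
  -- pairwise θ-apart.
  LargeMul : (List ℕ → Set) → ℕ → List ℕ → Set
  LargeMul P k X =
    Σ (Vec (List ℕ) k) λ Xs →
      (∀ i → FinSet (lookup Xs i)) ×
      (∀ i → lookup Xs i ⊆ₛ X) ×
      (∀ i → P (lookup Xs i)) ×
      (∀ i j → i Fin.< j → (lookup Xs i <ₛ lookup Xs j) × Apart (lookup Xs i) (lookup Xs j))

  -- X is ω^n-large(θ).  (X is a strictly increasing list, so its head is min X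
  -- and its tail is X ∖ {min X}.)
  Large : ℕ → List ℕ → Set
  Large zero [] = ⊥
  Large zero (_ ∷ _) = ⊤
  Large (suc n) [] = ⊥
  Large (suc n) (m ∷ X) = LargeMul (Large n) m X

Sparse : List ℕ → Set
Sparse X = ∀ {x y} → x ∈ X → y ∈ X → x < y → x ^ (x ^ x) < y

module Submission where

-- If every ω^j-large set with elements ≥ b contains an element ≥ f b, then an ω^(j+1)-large set
-- with minimum m ≥ b is a chain of m consecutive ω^j-large blocks, and passing the bound along the
-- chain yields an element ≥ (f ∘ suc)^m (b). Three such rounds starting from f = id produce a
-- fourfold exponential, which exceeds b^(b^b): an ω^j-large set with j ≥ 3 reaches beyond the
-- tower of its lower bound.
-- Now let X be ω^(2n+3)-large with minimum m and blocks P_i. The minimum p_i of P_i is at least 2,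
-- so P_i has two ω^(2n+1)-large blocks R₀ < R₁; R₀ reaches beyond p_i^(p_i^p_i), and by induction
-- R₁ contains a sparse ω^n-large Q_i. Everything below P_j is below p_j, hence {m} ∪ ⋃ Q_i is
-- sparse, and it is ω^(n+1)-large because the Q_i inherit θ-apartness from the P_i.

open import Defs
open import Data.Nat using (ℕ; zero; suc; _≤_; _<_; _+_; _*_; _^_; z≤n; s≤s; s≤s⁻¹; _≤′_; ≤′-refl; ≤′-step)
open import Data.Nat.Properties
open import Data.Nat.GeneralisedArithmetic using (iterate; iterate-is-fold; +-is-fold)
open import Data.Bool using (Bool)
open import Data.Vec using (Vec; []; _∷_; lookup)
import Data.Vec as Vec
open import Data.Vec.Properties using (lookup∘tabulate)
open import Data.List using (List; []; _∷_; concat; tabulate)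
open import Data.List.Membership.Propositional using (_∈_)
open import Data.List.Membership.Propositional.Properties using (∈-concat⁺′; ∈-concat⁻′; ∈-tabulate⁺; ∈-tabulate⁻)
import Data.List.Relation.Unary.All as All
import Data.List.Relation.Unary.All.Properties as All
import Data.List.Relation.Unary.AllPairs as AllPairs
open import Data.List.Relation.Unary.AllPairs.Properties using (concat⁺; tabulate⁺-<)
open import Data.List.Relation.Unary.Any using (here; there)
open import Data.List.Relation.Unary.Linked using ([-])
open import Data.List.Relation.Unary.Linked.Properties using (Linked⇒AllPairs; AllPairs⇒Linked)
open import Data.Fin using (Fin; zero; suc)
import Data.Fin as Fin
import Data.Fin.Properties as Fin
open import Data.Product using (Σ; Σ-syntax; ∃-syntax; _×_; _,_; proj₁; proj₂)
open import Data.Empty using (⊥-elim)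
open import Data.Unit using (tt)
open import Relation.Nullary using (Dec; ¬_)
open import Function using (_∘_)
open import Relation.Binary.Definitions using (tri<; tri≈; tri>)
open import Relation.Binary.PropositionalEquality using (_≡_; refl; sym; trans; cong; subst; subst₂; module ≡-Reasoning)

tower : ℕ → ℕ
tower x = x ^ (x ^ x)

2^suc : ∀ n → 2 ^ suc n ≡ 2 ^ n + 2 ^ n
2^suc n = cong (2 ^ n +_) (+-identityʳ (2 ^ n))

n<2^n : ∀ n → n < 2 ^ n
n<2^n zero = s≤s z≤n
n<2^n (suc n) = ≤-trans (+-mono-≤ (m^n>0 2 n) (n<2^n n)) (≤-reflexive (sym (2^suc n)))

n+n≤2^n : ∀ n → n + n ≤ 2 ^ n
n+n≤2^n zero = z≤n
n+n≤2^n (suc n) = ≤-trans (+-mono-≤ (n<2^n n) (n<2^n n)) (≤-reflexive (sym (2^suc n)))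

m^n≤2^[m*n] : ∀ m n → m ^ n ≤ 2 ^ (m * n)
m^n≤2^[m*n] m n = ≤-trans (^-monoˡ-≤ n (<⇒≤ (n<2^n m))) (≤-reflexive (^-*-assoc 2 m n))

tower-mono-≤ : ∀ {x y} → x ≤ y → tower x ≤ tower y
tower-mono-≤ {zero} _ = z≤n
tower-mono-≤ {suc x} {suc y} x≤y =
  ≤-trans (^-monoˡ-≤ (suc x ^ suc x) x≤y)
          (^-monoʳ-≤ (suc y) (≤-trans (^-monoˡ-≤ (suc x) x≤y) (^-monoʳ-≤ (suc y) x≤y)))

Inflationary : (ℕ → ℕ) → Set
Inflationary g = ∀ x → x ≤ g x

iterate-inflationary : ∀ {g} → Inflationary g → ∀ y k → y ≤ iterate g y k
iterate-inflationary infl y zero = ≤-refl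
iterate-inflationary {g} infl y (suc k) = ≤-trans (infl y) (iterate-inflationary infl (g y) k)

iterate-monoʳ-≤ : ∀ {g} → Inflationary g → ∀ y {k l} → k ≤ l → iterate g y k ≤ iterate g y l
iterate-monoʳ-≤ infl y {l = l} z≤n = iterate-inflationary infl y l
iterate-monoʳ-≤ {g} infl y (s≤s k≤l) = iterate-monoʳ-≤ infl (g y) k≤l

iterate-suc : ∀ y k → iterate suc y k ≡ k + y
iterate-suc y k = trans (sym (iterate-is-fold y suc k)) (+-is-fold k)

iterate-double : ∀ y k → iterate (2 *_) y k ≡ 2 ^ k * y
iterate-double y zero = sym (*-identityˡ y)
iterate-double y (suc k) = begin
  iterate (2 *_) (2 * y) k  ≡⟨ iterate-double (2 * y) k ⟩
  2 ^ k * (2 * y)           ≡⟨ sym (*-assoc (2 ^ k) 2 y) ⟩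
  2 ^ k * 2 * y             ≡⟨ cong (_* y) (*-comm (2 ^ k) 2) ⟩
  2 ^ suc k * y             ∎
  where open ≡-Reasoning

tower≤iterate-2^ : ∀ b → 4 ≤ b → tower b ≤ iterate (2 ^_) b b
tower≤iterate-2^ b 4≤b = begin
  b ^ (b ^ b)                ≤⟨ m^n≤2^[m*n] b (b ^ b) ⟩
  2 ^ (b ^ suc b)            ≤⟨ ^-monoʳ-≤ 2 (m^n≤2^[m*n] b (suc b)) ⟩
  2 ^ (2 ^ (b * suc b))      ≤⟨ ^-monoʳ-≤ 2 (^-monoʳ-≤ 2 b*[1+b]≤2^[b+b]) ⟩
  2 ^ (2 ^ (2 ^ (b + b)))    ≤⟨ ^-monoʳ-≤ 2 (^-monoʳ-≤ 2 (^-monoʳ-≤ 2 (n+n≤2^n b))) ⟩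
  2 ^ (2 ^ (2 ^ (2 ^ b)))    ≤⟨ iterate-monoʳ-≤ (<⇒≤ ∘ n<2^n) b 4≤b ⟩
  iterate (2 ^_) b b         ∎
  where
  open ≤-Reasoning
  b*[1+b]≤2^[b+b] : b * suc b ≤ 2 ^ (b + b)
  b*[1+b]≤2^[b+b] = ≤-trans (*-mono-≤ (<⇒≤ (n<2^n b)) (n<2^n b)) (≤-reflexive (sym (^-distribˡ-+-* 2 b b)))

_≤ₑ_ : ℕ → List ℕ → Set
b ≤ₑ A = ∀ {a} → a ∈ A → b ≤ a

_<ₑ_ : ℕ → List ℕ → Set
x <ₑ A = suc x ≤ₑ A

_≪_ : ℕ → List ℕ → Set
x ≪ A = tower x <ₑ A

finSet-head : ∀ {x xs} → FinSet (x ∷ xs) → x <ₑ xs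
finSet-head fin = All.lookup (AllPairs.head (Linked⇒AllPairs <-trans fin))

finSet-∷ : ∀ {x xs} → x <ₑ xs → FinSet xs → FinSet (x ∷ xs)
finSet-∷ x<xs fin = AllPairs⇒Linked (All.tabulate x<xs AllPairs.∷ Linked⇒AllPairs <-trans fin)

⋃ : ∀ {k} → (Fin k → List ℕ) → List ℕ
⋃ Q = concat (tabulate Q)

∈-⋃⁺ : ∀ {k} (Q : Fin k → List ℕ) i → Q i ⊆ₛ ⋃ Q
∈-⋃⁺ Q i a∈ = ∈-concat⁺′ a∈ (∈-tabulate⁺ i)

∈-⋃⁻ : ∀ {k} (Q : Fin k → List ℕ) {a} → a ∈ ⋃ Q → ∃[ i ] a ∈ Q i
∈-⋃⁻ Q a∈ with ∈-concat⁻′ (tabulate Q) a∈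
... | _ , a∈A , A∈ with ∈-tabulate⁻ A∈
... | i , refl = i , a∈A

finSet-⋃ : ∀ {k} (Q : Fin k → List ℕ) → (∀ i → FinSet (Q i)) →
           (∀ {i j} → i Fin.< j → Q i <ₛ Q j) → FinSet (⋃ Q)
finSet-⋃ Q fin ord = AllPairs⇒Linked (concat⁺
  (All.tabulate⁺ (λ i → Linked⇒AllPairs <-trans (fin i)))
  (tabulate⁺-< (λ i<j → All.tabulate (λ a∈ → All.tabulate (ord i<j a∈)))))

sparse-∷ : ∀ {x xs} → FinSet (x ∷ xs) → x ≪ xs → Sparse xs → Sparse (x ∷ xs)
sparse-∷ fin far sp (here refl) (here refl) x<x = ⊥-elim (<-irrefl refl x<x)
sparse-∷ fin far sp (here refl) (there y∈) _ = far y∈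
sparse-∷ fin far sp (there x∈) (here refl) x<y = ⊥-elim (<-asym x<y (finSet-head fin x∈))
sparse-∷ fin far sp (there x∈) (there y∈) x<y = sp x∈ y∈ x<y

sparse-⋃ : ∀ {k} (Q : Fin k → List ℕ) → (∀ i → Sparse (Q i)) →
           (∀ {i j} → i Fin.< j → Q i <ₛ Q j) →
           (∀ {i j} → i Fin.< j → ∀ {x} → x ∈ Q i → x ≪ Q j) → Sparse (⋃ Q)
sparse-⋃ Q sp ord far x∈ y∈ x<y with ∈-⋃⁻ Q x∈ | ∈-⋃⁻ Q y∈
... | i , x∈Qi | j , y∈Qj with Fin.<-cmp i j
... | tri< i<j _ _ = far i<j x∈Qi y∈Qj
... | tri≈ _ refl _ = sp i x∈Qi y∈Qj x<y
... | tri> _ _ j<i = ⊥-elim (<-asym x<y (ord j<i y∈Qj x∈Qi))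

module _ (θ : ℕ → ℕ → ℕ → Set) where

  apart-⊆ : ∀ {A B A′ B′} → A′ ⊆ₛ A → B′ ⊆ₛ B → Apart θ A B → Apart θ A′ B′
  apart-⊆ A′⊆A B′⊆B apart x (a , a∈ , x<a) with apart x (a , A′⊆A a∈ , x<a)
  ... | y , y<B , θxy = y , (λ b∈ → y<B (B′⊆B b∈)) , (λ z (b , b∈ , z<b) → θxy z (b , B′⊆B b∈ , z<b))

  ¬Large[] : ∀ k → ¬ Large θ k []
  ¬Large[] zero ()
  ¬Large[] (suc k) ()

  largeMul-tabulate : ∀ {P : List ℕ → Set} {k X} (Q : Fin k → List ℕ) →
                      (∀ i → FinSet (Q i)) → (∀ i → Q i ⊆ₛ X) → (∀ i → P (Q i)) →
                      (∀ i j → i Fin.< j → Q i <ₛ Q j × Apart θ (Q i) (Q j)) →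
                      LargeMul θ P k X
  largeMul-tabulate {P} {X = X} Q fin sub large sep =
    Vec.tabulate Q , (λ i → tab FinSet i (fin i)) , (λ i → tab (_⊆ₛ X) i (sub i)) ,
    (λ i → tab P i (large i)) ,
    (λ i j i<j → subst₂ (λ A B → A <ₛ B × Apart θ A B) (eq i) (eq j) (sep i j i<j))
    where
    eq : ∀ i → Q i ≡ lookup (Vec.tabulate Q) i
    eq i = sym (lookup∘tabulate Q i)
    tab : (R : List ℕ → Set) → ∀ i → R (Q i) → R (lookup (Vec.tabulate Q) i)
    tab R i = subst R (eq i)

  -- The bound 1 ≤ b matters: a set with minimum 0 is ω^(j+1)-large with no blocks at all.
  Reaches : ℕ → (ℕ → ℕ) → Set
  Reaches j f = ∀ {b Z} → 1 ≤ b → FinSet Z → b ≤ₑ Z → Large θ j Z → ∃[ w ] w ∈ Z × f b ≤ w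

  reaches-zero : Reaches 0 (λ b → b)
  reaches-zero {Z = x ∷ _} _ _ b≤Z _ = x , here refl , b≤Z (here refl)

  reaches-suc : ∀ {j f} → Reaches j f → Reaches (suc j) f
  reaches-suc r {Z = zero ∷ _} 1≤b _ b≤Z _ with ≤-trans 1≤b (b≤Z (here refl))
  ... | ()
  reaches-suc r {Z = suc _ ∷ _} 1≤b fin b≤Z (Ws , finW , subW , largeW , _)
    with r 1≤b (finW zero) (λ e∈ → <⇒≤ (≤-<-trans (b≤Z (here refl)) (finSet-head fin (subW zero e∈))))
           (largeW zero)
  ... | w , w∈ , le = w , there (subW zero w∈) , le

  reaches-≤′ : ∀ {j j′ f} → j ≤′ j′ → Reaches j f → Reaches j′ f
  reaches-≤′ ≤′-refl r = r
  reaches-≤′ (≤′-step j≤j′) r = reaches-suc (reaches-≤′ j≤j′ r)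

  module _ {j f g} (r : Reaches j f) (infl : Inflationary g) (g≤f : ∀ y → g y ≤ f (suc y)) where

    -- Block W_i contains an element ≥ g y, which bounds the later blocks from below.
    reaches-chain : ∀ {Z} k (Ws : Vec (List ℕ) (suc k)) {y} → 1 ≤ y →
                    (∀ i → FinSet (lookup Ws i)) → (∀ i → lookup Ws i ⊆ₛ Z) →
                    (∀ i → Large θ j (lookup Ws i)) → (∀ i → y <ₑ lookup Ws i) →
                    (∀ i i′ → i Fin.< i′ → lookup Ws i <ₛ lookup Ws i′) →
                    ∃[ w ] w ∈ Z × iterate g y (suc k) ≤ w
    reaches-chain zero (W ∷ []) {y} _ fin sub large y<W _
      with r (s≤s z≤n) (fin zero) (y<W zero) (large zero)
    ... | w , w∈ , le = w , sub zero w∈ , ≤-trans (g≤f y) le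
    reaches-chain (suc k) (W ∷ Ws) {y} 1≤y fin sub large y<W ord
      with r (s≤s z≤n) (fin zero) (y<W zero) (large zero)
    ... | w₀ , w₀∈ , le = reaches-chain k Ws (≤-trans 1≤y (infl y))
      (λ i → fin (suc i)) (λ i → sub (suc i)) (λ i → large (suc i))
      (λ i e∈ → ≤-<-trans (≤-trans (g≤f y) le) (ord zero (suc i) (s≤s z≤n) w₀∈ e∈))
      (λ i i′ i<i′ → ord (suc i) (suc i′) (s≤s i<i′))

    reaches-step : Reaches (suc j) (λ b → iterate g b b)
    reaches-step {Z = zero ∷ _} 1≤b _ b≤Z _ with ≤-trans 1≤b (b≤Z (here refl))
    ... | ()
    reaches-step {b} {Z = suc k ∷ _} 1≤b fin b≤Z (Ws , finW , subW , largeW , sepW)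
      with reaches-chain k Ws 1≤b finW (λ i → there ∘ subW i) largeW
             (λ i e∈ → ≤-<-trans (b≤Z (here refl)) (finSet-head fin (subW i e∈)))
             (λ i i′ i<i′ → proj₁ (sepW i i′ i<i′))
    ... | w , w∈ , le = w , w∈ , ≤-trans (iterate-monoʳ-≤ infl b (b≤Z (here refl))) le

  reaches-iterate-2^ : ∀ {j} → 3 ≤ j → Reaches j (λ b → iterate (2 ^_) b b)
  reaches-iterate-2^ 3≤j = reaches-≤′ (≤⇒≤′ 3≤j) (reaches-step reaches-2 (<⇒≤ ∘ n<2^n) 2^y≤)
    where
    reaches-1 : Reaches 1 (λ b → iterate suc b b)
    reaches-1 = reaches-step reaches-zero n≤1+n (λ _ → ≤-refl)
    2*y≤ : ∀ y → 2 * y ≤ iterate suc (suc y) (suc y)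
    2*y≤ y = begin
      2 * y                        ≤⟨ *-monoʳ-≤ 2 (n≤1+n y) ⟩
      suc y + (suc y + 0)          ≡⟨ cong (suc y +_) (+-identityʳ (suc y)) ⟩
      suc y + suc y                ≡⟨ sym (iterate-suc (suc y) (suc y)) ⟩
      iterate suc (suc y) (suc y)  ∎
      where open ≤-Reasoning
    reaches-2 : Reaches 2 (λ b → iterate (2 *_) b b)
    reaches-2 = reaches-step reaches-1 (λ y → m≤m+n y (y + 0)) 2*y≤
    2^y≤ : ∀ y → 2 ^ y ≤ iterate (2 *_) (suc y) (suc y)
    2^y≤ y = ≤-trans (^-monoʳ-≤ 2 (n≤1+n y))
               (≤-trans (m≤m*n (2 ^ suc y) (suc y)) (≤-reflexive (sym (iterate-double (suc y) (suc y)))))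

  record SparseLargeSubset (n : ℕ) (X : List ℕ) : Set where
    field
      elems  : List ℕ
      finSet : FinSet elems
      ⊆X     : elems ⊆ₛ X
      large  : Large θ n elems
      sparse : Sparse elems

  open SparseLargeSubset

  FarAbove : List ℕ → List ℕ → Set
  FarAbove P Q = ∀ x → x <ₑ P → x ≪ Q

  -- The first block of P already reaches beyond tower (min P), and the sparse set is taken
  -- from the second block.
  sparseLargeFarAbove : ∀ n k → 3 ≤ k →
    (∀ X → FinSet X → 4 ≤ₑ X → Large θ k X → SparseLargeSubset n X) →
    ∀ P → FinSet P → 4 ≤ₑ P → Large θ (suc k) P →
    Σ[ S ∈ SparseLargeSubset n P ] FarAbove P (elems S)
  sparseLargeFarAbove n k 3≤k ih (zero ∷ _) _ 4≤P _ with 4≤P (here refl)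
  ... | ()
  sparseLargeFarAbove n k 3≤k ih (suc zero ∷ _) _ 4≤P _ with 4≤P (here refl)
  ... | s≤s ()
  sparseLargeFarAbove n k 3≤k ih (p@(suc (suc _)) ∷ P′) fin 4≤P (R₀ ∷ R₁ ∷ _ , finR , subR , largeR , sepR)
    with reaches-iterate-2^ 3≤k (≤-trans (s≤s z≤n) (4≤P (here refl))) (finR zero)
           (λ e∈ → <⇒≤ (finSet-head fin (subR zero e∈))) (largeR zero)
  ... | w , w∈R₀ , p-reaches-w = S′ , far
    where
    S : SparseLargeSubset n R₁
    S = ih R₁ (finR (suc zero)) (λ e∈ → 4≤P (there (subR (suc zero) e∈))) (largeR (suc zero))
    S′ : SparseLargeSubset n (p ∷ P′)
    S′ = record { SparseLargeSubset S ; ⊆X = λ e∈ → there (subR (suc zero) (⊆X S e∈)) }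
    far : FarAbove (p ∷ P′) (elems S)
    far x x<P y∈ = begin-strict
      tower x             ≤⟨ tower-mono-≤ (<⇒≤ (x<P (here refl))) ⟩
      tower p             ≤⟨ tower≤iterate-2^ p (4≤P (here refl)) ⟩
      iterate (2 ^_) p p  ≤⟨ p-reaches-w ⟩
      w                   <⟨ proj₁ (sepR zero (suc zero) (s≤s z≤n)) w∈R₀ (⊆X S y∈) ⟩
      _                   ∎
      where open ≤-Reasoning

  sparseLargeSubset : ∀ n k → 3 + 2 * n ≤ k →
    ∀ X → FinSet X → 4 ≤ₑ X → Large θ k X → SparseLargeSubset n X
  sparseLargeSubset zero k _ [] _ _ large = ⊥-elim (¬Large[] k large)
  sparseLargeSubset zero k _ (x ∷ _) _ _ _ = record
    { elems = x ∷ [] ; finSet = [-] ; ⊆X = λ { (here refl) → here refl } ; large = tt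
    ; sparse = sparse-∷ [-] (λ ()) (λ ()) }
  sparseLargeSubset (suc n) zero () _ _ _ _
  sparseLargeSubset (suc n) (suc zero) (s≤s ()) _ _ _ _
  sparseLargeSubset (suc n) (suc (suc k)) le [] _ _ ()
  sparseLargeSubset (suc n) (suc (suc k)) le (m ∷ X′) fin 4≤X (Ps , finP , subP , largeP , sepP) = record
    { elems = m ∷ ⋃ Q
    ; finSet = finSetY
    ; ⊆X = λ { (here refl) → here refl ; (there a∈) → there (⋃Q⊆X′ a∈) }
    ; large = largeMul-tabulate {Large θ n} Q (finSet ∘ S) (∈-⋃⁺ Q) (large ∘ S)
        (λ i j i<j → ordQ i<j , apart-⊆ (Q⊆P i) (Q⊆P j) (proj₂ (sepP i j i<j)))
    ; sparse = sparse-∷ finSetY m≪⋃Q (sparse-⋃ Q (sparse ∘ S) ordQ farQ)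
    }
    where
    3+2n≤k : 3 + 2 * n ≤ k
    3+2n≤k = s≤s⁻¹ (s≤s⁻¹ (≤-trans (≤-reflexive (cong (3 +_) (sym (*-suc 2 n)))) le))
    piece : (i : Fin m) → Σ[ S ∈ SparseLargeSubset n (lookup Ps i) ] FarAbove (lookup Ps i) (elems S)
    piece i = sparseLargeFarAbove n k (≤-trans (m≤m+n 3 (2 * n)) 3+2n≤k) (sparseLargeSubset n k 3+2n≤k)
                (lookup Ps i) (finP i) (λ a∈ → 4≤X (there (subP i a∈))) (largeP i)
    S : (i : Fin m) → SparseLargeSubset n (lookup Ps i)
    S i = proj₁ (piece i)
    Q : Fin m → List ℕ
    Q i = elems (S i)
    Q⊆P : ∀ i → Q i ⊆ₛ lookup Ps i
    Q⊆P i = ⊆X (S i)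
    ordQ : ∀ {i j} → i Fin.< j → Q i <ₛ Q j
    ordQ {i} {j} i<j a∈ b∈ = proj₁ (sepP i j i<j) (Q⊆P i a∈) (Q⊆P j b∈)
    ⋃Q⊆X′ : ⋃ Q ⊆ₛ X′
    ⋃Q⊆X′ a∈ with ∈-⋃⁻ Q a∈
    ... | i , a∈Qi = subP i (Q⊆P i a∈Qi)
    finSetY : FinSet (m ∷ ⋃ Q)
    finSetY = finSet-∷ (finSet-head fin ∘ ⋃Q⊆X′) (finSet-⋃ Q (finSet ∘ S) ordQ)
    m≪⋃Q : m ≪ ⋃ Q
    m≪⋃Q a∈ with ∈-⋃⁻ Q a∈
    ... | i , a∈Qi = proj₂ (piece i) m (finSet-head fin ∘ subP i) a∈Qi
    farQ : ∀ {i j} → i Fin.< j → ∀ {x} → x ∈ Q i → x ≪ Q j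
    farQ {i} {j} i<j x∈ = proj₂ (piece j) _ (proj₁ (sepP i j i<j) (Q⊆P i x∈))

lemma2p10 : (ζ : (z : ℕ) → Vec Bool z → ℕ → ℕ → ℕ → Set)
    → (ζ-dec : ∀ z v t x y → Dec (ζ z v t x y))
    → (C : ℕ → Bool) → (c : ℕ)
    → (n : ℕ) → (X : List ℕ) → FinSet X
    → (∀ {a} → a ∈ X → 4 ≤ a × c ≤ a)
    → Large (θ-of ζ C c) (2 * n + 7) X
    → Σ (List ℕ) λ Y → FinSet Y × Y ⊆ₛ X × Large (θ-of ζ C c) n Y × Sparse Y
lemma2p10 ζ _ C c n X fin bounds largeX = elems , finSet , ⊆X , large , sparse
  where
  3+2n≤2n+7 : 3 + 2 * n ≤ 2 * n + 7
  3+2n≤2n+7 = ≤-trans (≤-reflexive (+-comm 3 (2 * n))) (+-monoʳ-≤ (2 * n) (s≤s (s≤s (s≤s z≤n))))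
  open SparseLargeSubset (sparseLargeSubset (θ-of ζ C c) n (2 * n + 7) 3+2n≤2n+7 X fin (proj₁ ∘ bounds) largeX)
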